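{- Let $\mathcal{A}$ be a non-empty finite set of agents and $\mathcal{P}$ a non-empty countable set of atoms. The axiomatisation $\mathbf{AFL_K}$ described in the context is sound for the action formula logic over the class $\mathcal{K}$ of all Kripke models: every formula derivable in $\mathbf{AFL_K}$ is true at every pointed Kripke model under the semantics described in the context.
   Context: Formulae and action formulae: $\varphi ::= p \mid \neg\varphi \mid (\varphi\wedge\varphi) \mid \Box_a\varphi \mid [\alpha]\varphi$; $\alpha ::= ?\varphi \mid \alpha\cup\alpha \mid \alpha;\alpha \mid L_B(\alpha,\alpha)$, with $p\in\mathcal{P}$, $a\in\mathcal{A}$, $\emptyset\ne B\subseteq\mathcal{A}$. Modal formulae are those without $[\alpha]$. Usual abbreviations ($\top$, $\vee$, $\to$, $\leftrightarrow$, $\Diamond_a$, $\langle\alpha\rangle=\neg[\alpha]\neg$). Kripke models $M=(S,R,V)$ (non-empty $S$, $R_a\subseteq S\times S$ per agent, $V:\mathcal{P}\to2^S$). Action models $\mathsf{M}=(\mathsf{S},\to,\mathsf{pre})$ with finite non-empty $\mathsf{S}$, relations $\to_a$, preconditions; multi-pointed $(\mathsf{M},\mathsf{T})$. Execution $M\otimes\mathsf{M}$: states $(w,e)$ with $M,w\models\mathsf{pre}(e)$, $(w,e)R'_a(v,f)$ iff $wR_av$ and $e\to_af$, valuation inherited from $w$; $(M,w)\otimes(\mathsf{M},\mathsf{T})=(M\otimes\mathsf{M},(\{w\}\times\mathsf{T})\cap S')$. A formula is true at a set of states iff it is true at each of them. For action models, $M,w\models[\mathsf{M},\mathsf{T}]\varphi$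 iff $(M,w)\otimes(\mathsf{M},\mathsf{T})\models\varphi$ and $\langle\mathsf{M},e\rangle=\neg[\mathsf{M},\{e\}]\neg$. Sequential composition $(\mathsf{M},\mathsf{T})\otimes(\mathsf{M}',\mathsf{T}')$: domain $\mathsf{S}\times\mathsf{S}'$, $(e,e')\to_a(f,f')$ iff $e\to_af$ and $e'\to'_af'$, $\mathsf{pre}((e,e'))=\langle\mathsf{M},e\rangle\mathsf{pre}'(e')$, designated $\mathsf{T}\times\mathsf{T}'$. Translation $\tau$ (for $\mathcal{K}$): $\tau(?\varphi)$: points $t,s$, $\to_a=\{(t,s),(s,s)\}$ for all $a$, $\mathsf{pre}(t)=\varphi$, $\mathsf{pre}(s)=\top$, designated $\{t\}$. $\tau(\alpha\cup\beta)$: disjoint union of $\tau(\alpha)$ and $\tau(\beta)$ with union of designated sets. $\tau(\alpha;\beta)=\tau(\alpha)\otimes\tau(\beta)$. If $\tau(\alpha)=((\mathsf{S}^\alpha,\to^\alpha,\mathsf{pre}^\alpha),\mathsf{T}^\alpha)$, then $\tau(L_B(\alpha,\alpha))$ has domain $\mathsf{S}^\alpha\cup\{t,s\}$ ($t,s$ new), for $a\in B$: $\to_a=\to^\alpha_a\cup\{(s,s)\}\cup\{(t,u)\mid u\in\mathsf{T}^\alpha\}$, for $a\notin B$: $\to_a=\to^\alpha_a\cup\{(t,s),(s,s)\}$, $\mathsf{pre}(t)=\mathsf{pre}(s)=\top$ (otherwise $\mathsf{pre}^\alpha$), designated $\{t\}$. $\tau(L_B(\alpha,\beta))=\tau(L_B(\alpha\cup\beta,\alpha\cup\beta))$.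 Semantics at a pointed Kripke model: $M,w\models p$ iff $w\in V(p)$; Boolean clauses as usual; $M,w\models\Box_a\varphi$ iff $M,v\models\varphi$ for all $v$ with $wR_av$; $M,w\models[\alpha]\varphi$ iff $(M,w)\otimes\tau(\alpha)\models\varphi$. $\mathbf{AFL_K}$ consists of all instances of: propositional tautologies, $\Box_a(\varphi\to\psi)\to(\Box_a\varphi\to\Box_a\psi)$, modus ponens, necessitation for $\Box_a$, and LT: $[?\varphi]\psi\leftrightarrow(\varphi\to\psi)$ for modal $\psi$; LU: $[\alpha\cup\beta]\varphi\leftrightarrow([\alpha]\varphi\wedge[\beta]\varphi)$; LS: $[\alpha;\beta]\varphi\leftrightarrow[\alpha][\beta]\varphi$; LP: $[L_B(\alpha,\beta)]p\leftrightarrow p$; LN: $[L_B(\alpha,\beta)]\neg\varphi\leftrightarrow\neg[L_B(\alpha,\beta)]\varphi$; LC: $[L_B(\alpha,\beta)](\varphi\wedge\psi)\leftrightarrow([L_B(\alpha,\beta)]\varphi\wedge[L_B(\alpha,\beta)]\psi)$; LK1: $[L_B(\alpha,\beta)]\Box_a\varphi\leftrightarrow\Box_a[\alpha\cup\beta]\varphi$ for $a\in B$; LK2: $[L_B(\alpha,\beta)]\Box_a\varphi\leftrightarrow\Box_a\varphi$ for $a\notin B$; NecL: from $\vdash\varphi$ infer $\vdash[\alpha]\varphi$. -}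

module Defs where

open import Level using (0ℓ)
open import Data.Nat using (ℕ; zero; suc; _+_; _*_)
open import Data.Fin using (Fin; zero; suc; splitAt; remQuot; _≟_; raise)
open import Data.Bool using (Bool; true; false; _∧_; not)
open import Data.Sum using (_⊎_; inj₁; inj₂)
open import Data.Product using (Σ; _×_; _,_; proj₁; proj₂)
open import Data.Empty using (⊥)
open import Data.Unit using (⊤)
open import Relation.Nullary using (¬_)
open import Relation.Nullary.Decidable using (⌊_⌋)
open import Relation.Binary.PropositionalEquality using (_≡_)

-- Propositional skeletons (for "instances of propositional tautologies")

data PForm : Set where
  pvar : ℕ → PForm
  pneg : PForm → PForm
  pand : PForm → PForm → PForm

peval : (ℕ → Bool) → PForm → Bool
peval v (pvar i)   = v i
peval v (pneg χ)   = not (peval v χ)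
peval v (pand χ θ) = peval v χ ∧ peval v θ

Tautology : PForm → Set
Tautology χ = (v : ℕ → Bool) → peval v χ ≡ true

module Logic (nA : ℕ) (Atom : Set) (p₀ : Atom) where

  Agent : Set
  Agent = Fin nA

  _∈B_ : Agent → (Agent → Bool) → Set
  a ∈B B = B a ≡ true

  infixr 6 _∧'_
  data Form : Set
  data Act : Set

  data Form where
    atom : Atom → Form
    ¬'_  : Form → Form
    _∧'_ : Form → Form → Form
    □    : Agent → Form → Form
    [_]_ : Act → Form → Form

  data Act where
    ¿_   : Form → Act
    _∪'_ : Act → Act → Act
    _⨾_  : Act → Act → Act
    L    : (B : Agent → Bool) → Σ Agent (λ a → a ∈B B) → Act → Act → Act

  ⊤' : Form
  ⊤' = ¬' (atom p₀ ∧' ¬' atom p₀)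

  _⇒_ : Form → Form → Form
  φ ⇒ ψ = ¬' (φ ∧' ¬' ψ)

  _⇔_ : Form → Form → Form
  φ ⇔ ψ = (φ ⇒ ψ) ∧' (ψ ⇒ φ)

  Modal : Form → Set
  Modal (atom p)  = ⊤
  Modal (¬' φ)    = Modal φ
  Modal (φ ∧' ψ)  = Modal φ × Modal ψ
  Modal (□ a φ)   = Modal φ
  Modal ([ α ] φ) = ⊥

  inst : (ℕ → Form) → PForm → Form
  inst σ (pvar i)   = σ i
  inst σ (pneg χ)   = ¬' inst σ χ
  inst σ (pand χ θ) = inst σ χ ∧' inst σ θ

  -- Action models (finite, non-empty: domain Fin (suc k)) and the
  -- language of action model logic used for their preconditions

  data AMF : Set
  data AM : Set

  data AM where
    am : (k : ℕ) → (Agent → Fin (suc k) → Fin (suc k) → Bool)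
       → (Fin (suc k) → AMF) → AM

  dom : AM → Set
  dom (am k _ _) = Fin (suc k)

  arr : (𝖬 : AM) → Agent → dom 𝖬 → dom 𝖬 → Bool
  arr (am k r _) = r

  pre : (𝖬 : AM) → dom 𝖬 → AMF
  pre (am k _ p) = p

  data AMF where
    atom : Atom → AMF
    ¬'_  : AMF → AMF
    _∧'_ : AMF → AMF → AMF
    □    : Agent → AMF → AMF
    -- [𝖬∣T]φ = [𝖬,T]φ with T a set of designated points
    [_∣_]_ : (𝖬 : AM) → (dom 𝖬 → Bool) → AMF → AMF

  ⊤ᵃ : AMF
  ⊤ᵃ = ¬' (atom p₀ ∧' ¬' atom p₀)

  PAM : Set
  PAM = Σ AM (λ 𝖬 → dom 𝖬 → Bool)

  ⟨_,_⟩_ : (𝖬 : AM) → dom 𝖬 → AMF → AMF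
  ⟨ am k r p , e ⟩ φ = ¬' ([ am k r p ∣ (λ f → ⌊ f ≟ e ⌋) ] (¬' φ))

  testPAM : AMF → PAM
  testPAM φ = am 1 rel pr , des
    where
      -- point 0 = t, point 1 = s
      rel : Agent → Fin 2 → Fin 2 → Bool
      rel a zero (suc zero)       = true
      rel a (suc zero) (suc zero) = true
      rel a _ _                   = false
      pr : Fin 2 → AMF
      pr zero = φ
      pr (suc zero) = ⊤ᵃ
      des : Fin 2 → Bool
      des zero = true
      des (suc _) = false

  unionPAM : PAM → PAM → PAM
  unionPAM (am k r p , T) (am k' r' p' , T') = am (k + suc k') rel pr , des
    where
      rel : Agent → Fin (suc k + suc k') → Fin (suc k + suc k') → Bool
      rel a x y with splitAt (suc k) x | splitAt (suc k) y
      ... | inj₁ u | inj₁ v = r a u v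
      ... | inj₂ u | inj₂ v = r' a u v
      ... | _      | _      = false
      pr : Fin (suc k + suc k') → AMF
      pr x with splitAt (suc k) x
      ... | inj₁ u = p u
      ... | inj₂ u = p' u
      des : Fin (suc k + suc k') → Bool
      des x with splitAt (suc k) x
      ... | inj₁ u = T u
      ... | inj₂ u = T' u

  -- sequential composition (domain S × S' encoded via remQuot)
  seqPAM : PAM → PAM → PAM
  seqPAM (am k r p , T) (am k' r' p' , T') =
      am (k' + k * suc k') rel pr , des
    where
      N : ℕ
      N = suc k * suc k'
      rel : Agent → Fin N → Fin N → Bool
      rel a x y with remQuot {suc k} (suc k') x | remQuot {suc k} (suc k') y
      ... | (e , e') | (f , f') = r a e f ∧ r' a e' f'
      pr : Fin N → AMF
      pr x with remQuot {suc k} (suc k') x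
      ... | (e , e') = ⟨ am k r p , e ⟩ p' e'
      des : Fin N → Bool
      des x with remQuot {suc k} (suc k') x
      ... | (e , e') = T e ∧ T' e'

  -- the learning construction τ(L_B(α,α)) from τ(α)
  learnPAM : (Agent → Bool) → PAM → PAM
  learnPAM B (am k r p , T) = am (suc (suc k)) rel pr , des
    where
      -- point 0 = t, point 1 = s, point (2 + u) = old point u
      rel : Agent → Fin (suc (suc (suc k))) → Fin (suc (suc (suc k))) → Bool
      rel a (suc (suc u)) (suc (suc v)) = r a u v
      rel a (suc zero) (suc zero)       = true
      rel a zero (suc (suc u)) with B a
      ... | true  = T u
      ... | false = false
      rel a zero (suc zero) with B a
      ... | true  = false
      ... | false = true
      rel a _ _ = false
      pr : Fin (suc (suc (suc k))) → AMF
      pr (suc (suc u)) = p u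
      pr _             = ⊤ᵃ
      des : Fin (suc (suc (suc k))) → Bool
      des zero = true
      des (suc _) = false

  τ : Act → PAM
  emb : Form → AMF

  τ (¿ φ)         = testPAM (emb φ)
  τ (α ∪' β)      = unionPAM (τ α) (τ β)
  τ (α ⨾ β)       = seqPAM (τ α) (τ β)
  τ (L B _ α β)   = learnPAM B (unionPAM (τ α) (τ β))

  emb (atom p)  = atom p
  emb (¬' φ)    = ¬' emb φ
  emb (φ ∧' ψ)  = emb φ ∧' emb ψ
  emb (□ a φ)   = □ a (emb φ)
  emb ([ α ] φ) = [ proj₁ (τ α) ∣ proj₂ (τ α) ] emb φ

  record Model : Set₁ where
    field
      S : Set
      R : Agent → S → S → Set
      V : Atom → S → Set
  open Model public

  _⊗_ : Model → AM → Model
  _⊨ᵃ_,_ : (M : Model) → S M → AMF → Set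

  M ⊗ am k r p = record
    { S = Σ (S M × Fin (suc k)) (λ we → M ⊨ᵃ proj₁ we , p (proj₂ we))
    ; R = λ a x y → R M a (proj₁ (proj₁ x)) (proj₁ (proj₁ y))
                    × r a (proj₂ (proj₁ x)) (proj₂ (proj₁ y)) ≡ true
    ; V = λ q x → V M q (proj₁ (proj₁ x))
    }

  M ⊨ᵃ w , atom q = V M q w
  M ⊨ᵃ w , (¬' φ) = ¬ (M ⊨ᵃ w , φ)
  M ⊨ᵃ w , (φ ∧' ψ) = (M ⊨ᵃ w , φ) × (M ⊨ᵃ w , ψ)
  M ⊨ᵃ w , □ a φ = ∀ v → R M a w v → M ⊨ᵃ v , φ
  M ⊨ᵃ w , ([ am k r p ∣ T ] φ) =
    ∀ (t : Fin (suc k)) → T t ≡ true → (h : M ⊨ᵃ w , p t) →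
      (M ⊗ am k r p) ⊨ᵃ ((w , t) , h) , φ

  _⊨_,_ : (M : Model) → S M → Form → Set
  M ⊨ w , atom q = V M q w
  M ⊨ w , (¬' φ) = ¬ (M ⊨ w , φ)
  M ⊨ w , (φ ∧' ψ) = (M ⊨ w , φ) × (M ⊨ w , ψ)
  M ⊨ w , □ a φ = ∀ v → R M a w v → M ⊨ v , φ
  M ⊨ w , ([ α ] φ) with τ α
  ... | (am k r p , T) =
    ∀ (t : Fin (suc k)) → T t ≡ true → (h : M ⊨ᵃ w , p t) →
      (M ⊗ am k r p) ⊨ ((w , t) , h) , φ

  data ⊢_ : Form → Set where
    taut : (σ : ℕ → Form) (χ : PForm) → Tautology χ → ⊢ inst σ χ
    K    : ∀ a φ ψ → ⊢ (□ a (φ ⇒ ψ) ⇒ (□ a φ ⇒ □ a ψ))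
    MP   : ∀ {φ ψ} → ⊢ (φ ⇒ ψ) → ⊢ φ → ⊢ ψ
    Nec  : ∀ {φ} a → ⊢ φ → ⊢ □ a φ
    LT   : ∀ φ ψ → Modal ψ → ⊢ (([ ¿ φ ] ψ) ⇔ (φ ⇒ ψ))
    LU   : ∀ α β φ → ⊢ (([ α ∪' β ] φ) ⇔ (([ α ] φ) ∧' ([ β ] φ)))
    LS   : ∀ α β φ → ⊢ (([ α ⨾ β ] φ) ⇔ ([ α ] [ β ] φ))
    LP   : ∀ B ne α β p → ⊢ (([ L B ne α β ] atom p) ⇔ atom p)
    LN   : ∀ B ne α β φ →
           ⊢ (([ L B ne α β ] (¬' φ)) ⇔ (¬' ([ L B ne α β ] φ)))
    LC   : ∀ B ne α β φ ψ →
           ⊢ (([ L B ne α β ] (φ ∧' ψ))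
              ⇔ (([ L B ne α β ] φ) ∧' ([ L B ne α β ] ψ)))
    LK1  : ∀ B ne α β a φ → a ∈B B →
           ⊢ (([ L B ne α β ] □ a φ) ⇔ □ a ([ α ∪' β ] φ))
    LK2  : ∀ B ne α β a φ → B a ≡ false →
           ⊢ (([ L B ne α β ] □ a φ) ⇔ □ a φ)
    NecL : ∀ {φ} α → ⊢ φ → ⊢ ([ α ] φ)

-- Formulae are read through their embedding into the language of action
-- models, whose truth is invariant under bisimulation of Kripke models.  A
-- bounded morphism of action models induces a bisimulation of the executed
-- models, and an inert part of an action model (points with trivial
-- precondition that only see each other) collapses onto the original model.
-- Each reduction axiom then amounts to a bisimulation: the test point collapses
-- onto the current state; both summands of a union embed by bounded morphisms;
-- executing τ(α) and then τ(β) is bisimilar to executing τ(α;β); and in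
-- τ(L_B(α,β)) the point s is inert while the old points embed, giving LK2 and
-- LK1.  The propositional reasoning is classical, hence excluded middle.

module Submission where

open import Defs
open import Level using (0ℓ)
open import Axiom.ExcludedMiddle using (ExcludedMiddle)
open import Axiom.DoubleNegationElimination using (em⇒dne)
open import Data.Bool using (Bool; true; false; T; not; _∧_)
open import Data.Bool.Properties using (T-≡; T-∧; ∧-conicalˡ; ∧-conicalʳ)
open import Data.Empty using (⊥-elim)
open import Data.Fin using (Fin; zero; suc; splitAt; combine; remQuot; _↑ˡ_; _↑ʳ_)
open import Data.Fin.Properties
  using (splitAt-↑ˡ; splitAt-↑ʳ; splitAt⁻¹-↑ˡ; splitAt⁻¹-↑ʳ; remQuot-combine; combine-remQuot)
open import Data.Nat using (ℕ; suc)
open import Data.Product using (Σ; _×_; _,_; proj₁; proj₂)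
open import Data.Product.Function.NonDependent.Propositional using (_×-⇔_)
open import Data.Sum using (inj₁; inj₂)
open import Data.Unit using (⊤; tt)
open import Function.Bundles using (_⇔_; mk⇔; Equivalence)
open import Function.Construct.Composition using (_⇔-∘_)
open import Function.Construct.Identity using (⇔-id)
open import Function.Construct.Symmetry using (⇔-sym)
open import Function.Definitions using (Injective)
open import Function.Related.TypeIsomorphisms using (¬-cong-⇔)
open import Relation.Binary.PropositionalEquality
  using (_≡_; _≢_; refl; sym; trans; cong; cong₂; subst)
open import Relation.Nullary using (¬_)
open import Relation.Nullary.Decidable using (⌊_⌋; toWitness; fromWitness)

open Equivalence using (to; from)

false≢true : false ≢ true
false≢true ()

T-not : ∀ b → T (not b) ⇔ (¬ T b)
T-not true  = mk⇔ (λ ()) (λ ¬t → ¬t tt)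
T-not false = mk⇔ (λ _ ()) (λ _ → tt)

module Soundness (em : ExcludedMiddle 0ℓ) (nA : ℕ) (Atom : Set) (p₀ : Atom) where

  open Logic nA Atom p₀ hiding (_⇔_)

  _⊃_ : Set → Set → Set
  A ⊃ B = ¬ (A × ¬ B)

  ⊃-intro : ∀ {A B} → (A → B) → A ⊃ B
  ⊃-intro f (a , ¬b) = ¬b (f a)

  ⊃-elim : ∀ {A B} → A ⊃ B → A → B
  ⊃-elim g a = em⇒dne em (λ ¬b → g (a , ¬b))

  ⇔⇒⊃⊂ : ∀ {A B} → A ⇔ B → (A ⊃ B) × (B ⊃ A)
  ⇔⇒⊃⊂ A⇔B = ⊃-intro (to A⇔B) , ⊃-intro (from A⇔B)

  ⊤ᵃ-valid : ∀ M v → M ⊨ᵃ v , ⊤ᵃ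
  ⊤ᵃ-valid M v (h , ¬h) = ¬h h

  infix 25 [_]ᵖ_
  [_]ᵖ_ : PAM → AMF → AMF
  [ P ]ᵖ φ = [ proj₁ P ∣ proj₂ P ] φ

  ⊨ᵃ-nec : ∀ P {ψ} → (∀ M w → M ⊨ᵃ w , ψ) → ∀ M w → M ⊨ᵃ w , [ P ]ᵖ ψ
  ⊨ᵃ-nec (am _ _ _ , _) valid M w _ _ _ = valid _ _

  ⊨ᵃ-⟨⟩ : ∀ {M w k r p} (e : Fin (suc k)) ψ →
    (M ⊨ᵃ w , (⟨ am k r p , e ⟩ ψ)) ⇔
    Σ (M ⊨ᵃ w , p e) (λ h → (M ⊗ am k r p) ⊨ᵃ ((w , e) , h) , ψ)
  ⊨ᵃ-⟨⟩ {M} {w} {k} {r} {p} e ψ = mk⇔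
    (λ ◇ψ → em⇒dne em (λ ¬ψ → ◇ψ (λ f f≟e h ψh → ¬ψ (at-e (toWitness (from T-≡ f≟e)) h ψh))))
    (λ (h , ψh) □¬ψ → □¬ψ e (to T-≡ (fromWitness refl)) h ψh)
    where
      at-e : ∀ {f} → f ≡ e → (h : M ⊨ᵃ w , p f) → (M ⊗ am k r p) ⊨ᵃ ((w , f) , h) , ψ →
        Σ (M ⊨ᵃ w , p e) (λ h → (M ⊗ am k r p) ⊨ᵃ ((w , e) , h) , ψ)
      at-e refl h ψh = h , ψh

  record Bisimulation (M N : Model) (Z : S M → S N → Set) : Set where
    field
      atoms : ∀ {x y} q → Z x y → V M q x ⇔ V N q y
      forth : ∀ {x y} a x' → Z x y → R M a x x' → Σ (S N) (λ y' → R N a y y' × Z x' y')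
      back  : ∀ {x y} a y' → Z x y → R N a y y' → Σ (S M) (λ x' → R M a x x' × Z x' y')
  open Bisimulation

  ≡-bisimulation : ∀ {M} → Bisimulation M M _≡_
  atoms ≡-bisimulation q refl = ⇔-id _
  forth ≡-bisimulation a x' refl rx = x' , rx , refl
  back  ≡-bisimulation a y' refl ry = y' , ry , refl

  record IsBoundedMorphism (𝖬 𝖬' : AM) (f : dom 𝖬 → dom 𝖬') : Set where
    field
      pre-≡     : ∀ e → pre 𝖬' (f e) ≡ pre 𝖬 e
      arr-forth : ∀ a e e' → arr 𝖬 a e e' ≡ true → arr 𝖬' a (f e) (f e') ≡ true
      arr-back  : ∀ a e y → arr 𝖬' a (f e) y ≡ true →
                  Σ (dom 𝖬) (λ e' → f e' ≡ y × arr 𝖬 a e e' ≡ true)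
  open IsBoundedMorphism

  id-bounded : ∀ {𝖬} → IsBoundedMorphism 𝖬 𝖬 (λ e → e)
  pre-≡     id-bounded e = refl
  arr-forth id-bounded a e e' re = re
  arr-back  id-bounded a e y re = y , refl , re

  Lift : ∀ {M N} 𝖬 𝖬' → (S M → S N → Set) → (dom 𝖬 → dom 𝖬') →
    S (M ⊗ 𝖬) → S (N ⊗ 𝖬') → Set
  Lift (am _ _ _) (am _ _ _) Z f ((v , e) , _) ((v' , e') , _) = Z v v' × f e ≡ e'

  ⊗-bisimulation : ∀ {M N Z 𝖬 𝖬' f} → Bisimulation M N Z → IsBoundedMorphism 𝖬 𝖬' f →
    (∀ e {x y} → Z x y → (M ⊨ᵃ x , pre 𝖬 e) ⇔ (N ⊨ᵃ y , pre 𝖬 e)) →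
    Bisimulation (M ⊗ 𝖬) (N ⊗ 𝖬') (Lift 𝖬 𝖬' Z f)
  atoms (⊗-bisimulation {𝖬 = am _ _ _} {am _ _ _} b m pre⇔) q (z , _) = atoms b q z
  forth (⊗-bisimulation {N = N} {𝖬 = am _ _ _} {am _ _ _} {f} b m pre⇔)
        a ((v' , e') , h) (z , refl) (rv , re)
    with w' , rw , z' ← forth b a v' z rv
    = ((w' , f e') , subst (N ⊨ᵃ w' ,_) (sym (pre-≡ m e')) (to (pre⇔ e' z') h))
    , (rw , arr-forth m a _ e' re) , (z' , refl)
  back (⊗-bisimulation {N = N} {𝖬 = am _ _ _} {am _ _ _} b m pre⇔)
       {(_ , e) , _} a ((w' , y) , h) (z , refl) (rw , re)
    with e' , refl , re' ← arr-back m a e y re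
    with v' , rv , z' ← back b a w' z rw
    = ((v' , e') , from (pre⇔ e' z') (subst (N ⊨ᵃ w' ,_) (pre-≡ m e') h))
    , (rv , re') , (z' , refl)

  ⊨ᵃ-invariant : ∀ {M N Z} → Bisimulation M N Z →
    ∀ φ {x y} → Z x y → (M ⊨ᵃ x , φ) ⇔ (N ⊨ᵃ y , φ)
  ⊨ᵃ-invariant b (atom q) z = atoms b q z
  ⊨ᵃ-invariant b (¬' φ) z = ¬-cong-⇔ (⊨ᵃ-invariant b φ z)
  ⊨ᵃ-invariant b (φ ∧' ψ) z = ⊨ᵃ-invariant b φ z ×-⇔ ⊨ᵃ-invariant b ψ z
  ⊨ᵃ-invariant b (□ a φ) z = mk⇔
    (λ □φ y' ry → let x' , rx , z' = back b a y' z ry in to (⊨ᵃ-invariant b φ z') (□φ x' rx))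
    (λ □φ x' rx → let y' , ry , z' = forth b a x' z rx in from (⊨ᵃ-invariant b φ z') (□φ y' ry))
  ⊨ᵃ-invariant {M} {N} {Z} b ([ am k r p ∣ T ] φ) z = mk⇔
    (λ H t Tt h → to (⊨ᵃ-invariant b⊗ φ (z , refl)) (H t Tt (from (pre⇔ t z) h)))
    (λ H t Tt h → from (⊨ᵃ-invariant b⊗ φ (z , refl)) (H t Tt (to (pre⇔ t z) h)))
    where
      pre⇔ : ∀ e {x y} → Z x y → (M ⊨ᵃ x , p e) ⇔ (N ⊨ᵃ y , p e)
      pre⇔ e = ⊨ᵃ-invariant b (p e)
      b⊗ : Bisimulation (M ⊗ am k r p) (N ⊗ am k r p) (Lift (am k r p) (am k r p) Z (λ e → e))
      b⊗ = ⊗-bisimulation b (id-bounded {am k r p}) pre⇔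

  ⊨ᵃ-along : ∀ {𝖬 𝖬' f} → IsBoundedMorphism 𝖬 𝖬' f →
    ∀ {M} φ {x y} → Lift 𝖬 𝖬' _≡_ f x y → ((M ⊗ 𝖬) ⊨ᵃ x , φ) ⇔ ((M ⊗ 𝖬') ⊨ᵃ y , φ)
  ⊨ᵃ-along m = ⊨ᵃ-invariant (⊗-bisimulation ≡-bisimulation m (λ _ → λ { refl → ⇔-id _ }))

  -- Points of Q act as the trivial action: executing one of them leaves the
  -- model unchanged up to bisimulation.
  record Inert (𝖬 : AM) (Q : dom 𝖬 → Set) : Set where
    field
      closed : ∀ a {e f} → Q e → arr 𝖬 a e f ≡ true → Q f
      valid-successor : ∀ a {e} → Q e →
        Σ (dom 𝖬) (λ f → Q f × arr 𝖬 a e f ≡ true × pre 𝖬 f ≡ ⊤ᵃ)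
  open Inert

  Collapse : ∀ {M} 𝖬 → (dom 𝖬 → Set) → S (M ⊗ 𝖬) → S M → Set
  Collapse (am _ _ _) Q ((v , e) , _) v' = v ≡ v' × Q e

  inert-bisimulation : ∀ {M 𝖬 Q} → Inert 𝖬 Q → Bisimulation (M ⊗ 𝖬) M (Collapse 𝖬 Q)
  atoms (inert-bisimulation {𝖬 = am _ _ _} i) q (refl , _) = ⇔-id _
  forth (inert-bisimulation {𝖬 = am _ _ _} i) a ((v' , e') , _) (refl , qe) (rv , re) =
    v' , rv , (refl , closed i a qe re)
  back (inert-bisimulation {M} {am _ _ _} i) a v' (refl , qe) rv
    with f , qf , re , pre≡⊤ ← valid-successor i a qe
    = ((v' , f) , subst (M ⊨ᵃ v' ,_) (sym pre≡⊤) (⊤ᵃ-valid M v')) , (rv , re) , (refl , qf)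

  test-inert : ∀ φ → Inert (proj₁ (testPAM φ)) (λ _ → ⊤)
  closed (test-inert φ) a _ _ = tt
  valid-successor (test-inert φ) a {zero}     _ = suc zero , tt , refl , refl
  valid-successor (test-inert φ) a {suc zero} _ = suc zero , tt , refl , refl

  ⊨ᵃ-[test] : ∀ {M w} φ ψ → (M ⊨ᵃ w , [ testPAM φ ]ᵖ ψ) ⇔ ((M ⊨ᵃ w , φ) ⊃ (M ⊨ᵃ w , ψ))
  ⊨ᵃ-[test] {M} {w} φ ψ = mk⇔
    (λ H → ⊃-intro (λ h → to collapse (H zero refl h)))
    (λ { G zero _ h → from collapse (⊃-elim G h) ; G (suc zero) () _ })
    where
      collapse : ∀ {h} → ((M ⊗ proj₁ (testPAM φ)) ⊨ᵃ ((w , zero) , h) , ψ) ⇔ (M ⊨ᵃ w , ψ)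
      collapse = ⊨ᵃ-invariant (inert-bisimulation (test-inert φ)) ψ (refl , tt)

  module Union {k k'} (r : Agent → Fin (suc k) → Fin (suc k) → Bool)
                      (r' : Agent → Fin (suc k') → Fin (suc k') → Bool)
                      (p : Fin (suc k) → AMF) (p' : Fin (suc k') → AMF)
                      (T : Fin (suc k) → Bool) (T' : Fin (suc k') → Bool) where

    𝖴 : AM
    𝖴 = proj₁ (unionPAM (am k r p , T) (am k' r' p' , T'))

    D : dom 𝖴 → Bool
    D = proj₂ (unionPAM (am k r p , T) (am k' r' p' , T'))

    inl : Fin (suc k) → dom 𝖴
    inl u = u ↑ˡ suc k'

    inr : Fin (suc k') → dom 𝖴
    inr u = suc k ↑ʳ u

    data Side : dom 𝖴 → Set where
      left  : ∀ u → Side (inl u)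
      right : ∀ u → Side (inr u)

    side : ∀ x → Side x
    side x with splitAt (suc k) x in eq
    ... | inj₁ u = subst Side (splitAt⁻¹-↑ˡ eq) (left u)
    ... | inj₂ u = subst Side (splitAt⁻¹-↑ʳ eq) (right u)

    arr-inl-inl : ∀ a u v → arr 𝖴 a (inl u) (inl v) ≡ r a u v
    arr-inl-inl a u v rewrite splitAt-↑ˡ (suc k) u (suc k') | splitAt-↑ˡ (suc k) v (suc k') = refl

    arr-inr-inr : ∀ a u v → arr 𝖴 a (inr u) (inr v) ≡ r' a u v
    arr-inr-inr a u v rewrite splitAt-↑ʳ (suc k) (suc k') u | splitAt-↑ʳ (suc k) (suc k') v = refl

    arr-inl-inr : ∀ a u v → arr 𝖴 a (inl u) (inr v) ≡ false
    arr-inl-inr a u v rewrite splitAt-↑ˡ (suc k) u (suc k') | splitAt-↑ʳ (suc k) (suc k') v = refl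

    arr-inr-inl : ∀ a u v → arr 𝖴 a (inr u) (inl v) ≡ false
    arr-inr-inl a u v rewrite splitAt-↑ʳ (suc k) (suc k') u | splitAt-↑ˡ (suc k) v (suc k') = refl

    D-inl : ∀ u → D (inl u) ≡ T u
    D-inl u rewrite splitAt-↑ˡ (suc k) u (suc k') = refl

    D-inr : ∀ u → D (inr u) ≡ T' u
    D-inr u rewrite splitAt-↑ʳ (suc k) (suc k') u = refl

    inl-bounded : IsBoundedMorphism (am k r p) 𝖴 inl
    pre-≡ inl-bounded u rewrite splitAt-↑ˡ (suc k) u (suc k') = refl
    arr-forth inl-bounded a u v re = trans (arr-inl-inl a u v) re
    arr-back inl-bounded a u y re with side y
    ... | left v  = v , refl , trans (sym (arr-inl-inl a u v)) re
    ... | right v = ⊥-elim (false≢true (trans (sym (arr-inl-inr a u v)) re))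

    inr-bounded : IsBoundedMorphism (am k' r' p') 𝖴 inr
    pre-≡ inr-bounded u rewrite splitAt-↑ʳ (suc k) (suc k') u = refl
    arr-forth inr-bounded a u v re = trans (arr-inr-inr a u v) re
    arr-back inr-bounded a u y re with side y
    ... | left v  = ⊥-elim (false≢true (trans (sym (arr-inr-inl a u v)) re))
    ... | right v = v , refl , trans (sym (arr-inr-inr a u v)) re

    ⊨ᵃ-[𝖴] : ∀ {M w} φ → (M ⊨ᵃ w , ([ 𝖴 ∣ D ] φ)) ⇔
      ((M ⊨ᵃ w , ([ am k r p ∣ T ] φ)) × (M ⊨ᵃ w , ([ am k' r' p' ∣ T' ] φ)))
    ⊨ᵃ-[𝖴] {M} {w} φ = mk⇔
      (λ H → (λ u Tu h → from (⊨ᵃ-along inl-bounded φ (refl , refl))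
                               (H (inl u) (trans (D-inl u) Tu) (pre-to inl-bounded u h)))
           , (λ u Tu h → from (⊨ᵃ-along inr-bounded φ (refl , refl))
                               (H (inr u) (trans (D-inr u) Tu) (pre-to inr-bounded u h))))
      (λ (Hl , Hr) x Dx h → from-sides Hl Hr x (side x) Dx h)
      where
        pre-to : ∀ {𝖬 f} (m : IsBoundedMorphism 𝖬 𝖴 f) u →
          M ⊨ᵃ w , pre 𝖬 u → M ⊨ᵃ w , pre 𝖴 (f u)
        pre-to m u = subst (M ⊨ᵃ w ,_) (sym (pre-≡ m u))
        pre-from : ∀ {𝖬 f} (m : IsBoundedMorphism 𝖬 𝖴 f) u →
          M ⊨ᵃ w , pre 𝖴 (f u) → M ⊨ᵃ w , pre 𝖬 u
        pre-from m u = subst (M ⊨ᵃ w ,_) (pre-≡ m u)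
        from-sides : M ⊨ᵃ w , ([ am k r p ∣ T ] φ) → M ⊨ᵃ w , ([ am k' r' p' ∣ T' ] φ) →
          ∀ x → Side x → D x ≡ true → (h : M ⊨ᵃ w , pre 𝖴 x) → (M ⊗ 𝖴) ⊨ᵃ ((w , x) , h) , φ
        from-sides Hl Hr _ (left u) Dx h = to (⊨ᵃ-along inl-bounded φ (refl , refl))
          (Hl u (trans (sym (D-inl u)) Dx) (pre-from inl-bounded u h))
        from-sides Hl Hr _ (right u) Dx h = to (⊨ᵃ-along inr-bounded φ (refl , refl))
          (Hr u (trans (sym (D-inr u)) Dx) (pre-from inr-bounded u h))

  ⊨ᵃ-[∪] : ∀ P Q {M w} φ →
    (M ⊨ᵃ w , [ unionPAM P Q ]ᵖ φ) ⇔ ((M ⊨ᵃ w , [ P ]ᵖ φ) × (M ⊨ᵃ w , [ Q ]ᵖ φ))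
  ⊨ᵃ-[∪] (am _ r p , T) (am _ r' p' , T') = Union.⊨ᵃ-[𝖴] r r' p p' T T'

  module Composition {k k'} (r : Agent → Fin (suc k) → Fin (suc k) → Bool)
                            (r' : Agent → Fin (suc k') → Fin (suc k') → Bool)
                            (p : Fin (suc k) → AMF) (p' : Fin (suc k') → AMF)
                            (T : Fin (suc k) → Bool) (T' : Fin (suc k') → Bool) where

    𝖠 𝖡 𝖢 : AM
    𝖠 = am k r p
    𝖡 = am k' r' p'
    𝖢 = proj₁ (seqPAM (𝖠 , T) (𝖡 , T'))

    D : dom 𝖢 → Bool
    D = proj₂ (seqPAM (𝖠 , T) (𝖡 , T'))

    ⟪_,_⟫ : Fin (suc k) → Fin (suc k') → dom 𝖢
    ⟪ e , e' ⟫ = combine e e'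

    data Pair : dom 𝖢 → Set where
      pair : ∀ e e' → Pair ⟪ e , e' ⟫

    pair-view : ∀ x → Pair x
    pair-view x = subst Pair (combine-remQuot {suc k} (suc k') x)
      (pair (proj₁ (remQuot {suc k} (suc k') x)) (proj₂ (remQuot {suc k} (suc k') x)))

    remQuot-⟪⟫ : ∀ {B : Set} (g : Fin (suc k) → Fin (suc k') → B) e e' →
      g (proj₁ (remQuot {suc k} (suc k') ⟪ e , e' ⟫)) (proj₂ (remQuot {suc k} (suc k') ⟪ e , e' ⟫))
        ≡ g e e'
    remQuot-⟪⟫ g e e' = cong (λ ee' → g (proj₁ ee') (proj₂ ee')) (remQuot-combine {suc k} {suc k'} e e')

    arr-⟪⟫ : ∀ a e e' f f' → arr 𝖢 a ⟪ e , e' ⟫ ⟪ f , f' ⟫ ≡ r a e f ∧ r' a e' f'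
    arr-⟪⟫ a e e' f f' =
      cong₂ (λ ee' ff' → r a (proj₁ ee') (proj₁ ff') ∧ r' a (proj₂ ee') (proj₂ ff'))
      (remQuot-combine {suc k} {suc k'} e e') (remQuot-combine {suc k} {suc k'} f f')

    pre-⟪⟫ : ∀ e e' → pre 𝖢 ⟪ e , e' ⟫ ≡ ⟨ 𝖠 , e ⟩ p' e'
    pre-⟪⟫ = remQuot-⟪⟫ (λ e e' → ⟨ 𝖠 , e ⟩ p' e')

    D-⟪⟫ : ∀ e e' → D ⟪ e , e' ⟫ ≡ T e ∧ T' e'
    D-⟪⟫ = remQuot-⟪⟫ (λ e e' → T e ∧ T' e')

    Related : ∀ {M} → S ((M ⊗ 𝖠) ⊗ 𝖡) → S (M ⊗ 𝖢) → Set
    Related ((((v , e) , _) , e') , _) ((v' , x) , _) = v ≡ v' × x ≡ ⟪ e , e' ⟫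

    composition-bisimulation : ∀ {M} → Bisimulation ((M ⊗ 𝖠) ⊗ 𝖡) (M ⊗ 𝖢) Related
    atoms composition-bisimulation q (refl , _) = ⇔-id _
    forth (composition-bisimulation {M}) {((((_ , e) , _) , e') , _)} a
          ((((v₂ , e₂) , h₂) , e₂') , h₂') (refl , refl) ((rv , re) , re') =
        ((v₂ , ⟪ e₂ , e₂' ⟫) , subst (M ⊨ᵃ v₂ ,_) (sym (pre-⟪⟫ e₂ e₂'))
                                  (from (⊨ᵃ-⟨⟩ {r = r} {p = p} e₂ (p' e₂')) (h₂ , h₂')))
      , (rv , trans (arr-⟪⟫ a e e' e₂ e₂') (cong₂ _∧_ re re'))
      , (refl , refl)
    back (composition-bisimulation {M}) {((((_ , e) , _) , e') , _)} a
         ((v₂ , x₂) , h) (refl , refl) (rv , rx) with pair-view x₂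
    ... | pair e₂ e₂' =
        let h₂ , h₂' = to (⊨ᵃ-⟨⟩ {r = r} {p = p} e₂ (p' e₂'))
                          (subst (M ⊨ᵃ v₂ ,_) (pre-⟪⟫ e₂ e₂') h)
            r∧r' = trans (sym (arr-⟪⟫ a e e' e₂ e₂')) rx
        in ((((v₂ , e₂) , h₂) , e₂') , h₂')
         , ((rv , ∧-conicalˡ _ _ r∧r') , ∧-conicalʳ _ _ r∧r')
         , (refl , refl)

    ⊨ᵃ-[𝖢] : ∀ {M w} φ → (M ⊨ᵃ w , ([ 𝖢 ∣ D ] φ)) ⇔ (M ⊨ᵃ w , ([ 𝖠 ∣ T ] ([ 𝖡 ∣ T' ] φ)))
    ⊨ᵃ-[𝖢] {M} {w} φ = mk⇔
      (λ H e Te h e' Te' h' → from (⊨ᵃ-invariant composition-bisimulation φ (refl , refl))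
         (H ⟪ e , e' ⟫ (trans (D-⟪⟫ e e') (cong₂ _∧_ Te Te'))
            (subst (M ⊨ᵃ w ,_) (sym (pre-⟪⟫ e e')) (from (⊨ᵃ-⟨⟩ {r = r} {p = p} e (p' e')) (h , h')))))
      (λ H x Dx h → from-pair H x (pair-view x) Dx h)
      where
        from-pair : M ⊨ᵃ w , ([ 𝖠 ∣ T ] ([ 𝖡 ∣ T' ] φ)) →
          ∀ x → Pair x → D x ≡ true → (h : M ⊨ᵃ w , pre 𝖢 x) → (M ⊗ 𝖢) ⊨ᵃ ((w , x) , h) , φ
        from-pair H _ (pair e e') Dx h =
          let h₁ , h₂ = to (⊨ᵃ-⟨⟩ {r = r} {p = p} e (p' e')) (subst (M ⊨ᵃ w ,_) (pre-⟪⟫ e e') h)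
              T∧T' = trans (sym (D-⟪⟫ e e')) Dx
          in to (⊨ᵃ-invariant composition-bisimulation φ (refl , refl))
                (H e (∧-conicalˡ _ _ T∧T') h₁ e' (∧-conicalʳ _ _ T∧T') h₂)

  ⊨ᵃ-[⨾] : ∀ P Q {M w} φ → (M ⊨ᵃ w , [ seqPAM P Q ]ᵖ φ) ⇔ (M ⊨ᵃ w , [ P ]ᵖ [ Q ]ᵖ φ)
  ⊨ᵃ-[⨾] (am _ r p , T) (am _ r' p' , T') = Composition.⊨ᵃ-[𝖢] r r' p p' T T'

  -- Points of 𝖫: zero is the designated t, suc zero is s, suc (suc u) is u.
  module Learning (B : Agent → Bool) {k} (r : Agent → Fin (suc k) → Fin (suc k) → Bool)
                  (p : Fin (suc k) → AMF) (T : Fin (suc k) → Bool) where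

    𝖫 : AM
    𝖫 = proj₁ (learnPAM B (am k r p , T))

    D : dom 𝖫 → Bool
    D = proj₂ (learnPAM B (am k r p , T))

    t-s-learner : ∀ {a} → B a ≡ true → arr 𝖫 a zero (suc zero) ≡ false
    t-s-learner eq rewrite eq = refl

    t-s-other : ∀ {a} → B a ≡ false → arr 𝖫 a zero (suc zero) ≡ true
    t-s-other eq rewrite eq = refl

    t-old-learner : ∀ {a} u → B a ≡ true → arr 𝖫 a zero (suc (suc u)) ≡ T u
    t-old-learner u eq rewrite eq = refl

    t-old-other : ∀ {a} u → B a ≡ false → arr 𝖫 a zero (suc (suc u)) ≡ false
    t-old-other u eq rewrite eq = refl

    old-bounded : IsBoundedMorphism (am k r p) 𝖫 (λ u → suc (suc u))
    pre-≡ old-bounded u = refl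
    arr-forth old-bounded a u v re = re
    arr-back old-bounded a u (suc (suc v)) re = v , refl , re

    s-inert : Inert 𝖫 (_≡ suc zero)
    closed s-inert a {f = suc zero} refl re = refl
    valid-successor s-inert a refl = suc zero , refl , refl , refl

    At : ∀ M → S M → AMF → Set
    At M w χ = (M ⊗ 𝖫) ⊨ᵃ ((w , zero) , ⊤ᵃ-valid M w) , χ

    ⊨ᵃ-[𝖫] : ∀ {M w} χ → (M ⊨ᵃ w , ([ 𝖫 ∣ D ] χ)) ⇔ At M w χ
    ⊨ᵃ-[𝖫] {M} {w} χ = mk⇔
      (λ H → H zero refl (⊤ᵃ-valid M w))
      (λ { G zero _ h → to (⊨ᵃ-along (id-bounded {𝖫}) χ (refl , refl)) G ; G (suc _) () _ })

    At-□-learner : ∀ {M w a} χ → B a ≡ true →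
      At M w (□ a χ) ⇔ (M ⊨ᵃ w , □ a ([ am k r p ∣ T ] χ))
    At-□-learner {M} {w} {a} χ eq = mk⇔
      (λ H v rv u Tu h → from (along-old h)
         (H ((v , suc (suc u)) , h) (rv , trans (t-old-learner u eq) Tu)))
      old-successors
      where
        along-old : ∀ {v u} h →
          ((M ⊗ am k r p) ⊨ᵃ ((v , u) , h) , χ) ⇔ ((M ⊗ 𝖫) ⊨ᵃ ((v , suc (suc u)) , h) , χ)
        along-old h = ⊨ᵃ-along old-bounded χ (refl , refl)
        old-successors : M ⊨ᵃ w , □ a ([ am k r p ∣ T ] χ) → At M w (□ a χ)
        old-successors H ((v , suc zero) , _) (rv , re) =
          ⊥-elim (false≢true (trans (sym (t-s-learner eq)) re))
        old-successors H ((v , suc (suc u)) , h) (rv , re) =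
          to (along-old h) (H v rv u (trans (sym (t-old-learner u eq)) re) h)

    At-□-other : ∀ {M w a} χ → B a ≡ false → At M w (□ a χ) ⇔ (M ⊨ᵃ w , □ a χ)
    At-□-other {M} {w} {a} χ eq = mk⇔
      (λ H v rv → to (collapse-s χ) (H ((v , suc zero) , ⊤ᵃ-valid M v) (rv , t-s-other eq)))
      s-successor
      where
        collapse-s : ∀ {v h} χ → ((M ⊗ 𝖫) ⊨ᵃ ((v , suc zero) , h) , χ) ⇔ (M ⊨ᵃ v , χ)
        collapse-s χ = ⊨ᵃ-invariant (inert-bisimulation s-inert) χ (refl , refl)
        s-successor : M ⊨ᵃ w , □ a χ → At M w (□ a χ)
        s-successor H ((v , suc zero) , _) (rv , _) = from (collapse-s χ) (H v rv)
        s-successor H ((v , suc (suc u)) , _) (_ , re) =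
          ⊥-elim (false≢true (trans (sym (t-old-other u eq)) re))

  module _ (B : Agent → Bool) where
    open Learning B

    ⊨ᵃ-[learn]-atom : ∀ P {M w} q → (M ⊨ᵃ w , [ learnPAM B P ]ᵖ atom q) ⇔ V M q w
    ⊨ᵃ-[learn]-atom (am _ r p , T) q = ⊨ᵃ-[𝖫] r p T (atom q)

    ⊨ᵃ-[learn]-¬ : ∀ P {M w} χ →
      (M ⊨ᵃ w , [ learnPAM B P ]ᵖ (¬' χ)) ⇔ (¬ M ⊨ᵃ w , [ learnPAM B P ]ᵖ χ)
    ⊨ᵃ-[learn]-¬ (am _ r p , T) χ = ⇔-sym (¬-cong-⇔ (⊨ᵃ-[𝖫] r p T χ)) ⇔-∘ ⊨ᵃ-[𝖫] r p T (¬' χ)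

    ⊨ᵃ-[learn]-∧ : ∀ P {M w} χ ψ →
      (M ⊨ᵃ w , [ learnPAM B P ]ᵖ (χ ∧' ψ)) ⇔
      ((M ⊨ᵃ w , [ learnPAM B P ]ᵖ χ) × (M ⊨ᵃ w , [ learnPAM B P ]ᵖ ψ))
    ⊨ᵃ-[learn]-∧ (am _ r p , T) χ ψ =
      ⇔-sym (⊨ᵃ-[𝖫] r p T χ ×-⇔ ⊨ᵃ-[𝖫] r p T ψ) ⇔-∘ ⊨ᵃ-[𝖫] r p T (χ ∧' ψ)

    ⊨ᵃ-[learn]-□-learner : ∀ P {M w a} χ → B a ≡ true →
      (M ⊨ᵃ w , [ learnPAM B P ]ᵖ □ a χ) ⇔ (M ⊨ᵃ w , □ a ([ P ]ᵖ χ))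
    ⊨ᵃ-[learn]-□-learner (am _ r p , T) χ eq = At-□-learner r p T χ eq ⇔-∘ ⊨ᵃ-[𝖫] r p T (□ _ χ)

    ⊨ᵃ-[learn]-□-other : ∀ P {M w a} χ → B a ≡ false →
      (M ⊨ᵃ w , [ learnPAM B P ]ᵖ □ a χ) ⇔ (M ⊨ᵃ w , □ a χ)
    ⊨ᵃ-[learn]-□-other (am _ r p , T) χ eq = At-□-other r p T χ eq ⇔-∘ ⊨ᵃ-[𝖫] r p T (□ _ χ)

  ⊨⇔⊨ᵃ-emb : ∀ φ {M w} → (M ⊨ w , φ) ⇔ (M ⊨ᵃ w , emb φ)
  ⊨⇔⊨ᵃ-emb (atom q) = ⇔-id _
  ⊨⇔⊨ᵃ-emb (¬' φ) = ¬-cong-⇔ (⊨⇔⊨ᵃ-emb φ)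
  ⊨⇔⊨ᵃ-emb (φ ∧' ψ) = ⊨⇔⊨ᵃ-emb φ ×-⇔ ⊨⇔⊨ᵃ-emb ψ
  ⊨⇔⊨ᵃ-emb (□ a φ) = mk⇔ (λ H v rv → to (⊨⇔⊨ᵃ-emb φ) (H v rv))
                          (λ H v rv → from (⊨⇔⊨ᵃ-emb φ) (H v rv))
  ⊨⇔⊨ᵃ-emb ([ α ] φ) with τ α
  ... | am _ _ _ , _ = mk⇔ (λ H t Tt h → to (⊨⇔⊨ᵃ-emb φ) (H t Tt h))
                           (λ H t Tt h → from (⊨⇔⊨ᵃ-emb φ) (H t Tt h))

  ⊨ᵃ-inst : ∀ {M w} (σ : ℕ → Form) (v : ℕ → Bool) →
    (∀ i → T (v i) ⇔ (M ⊨ᵃ w , emb (σ i))) →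
    ∀ χ → T (peval v χ) ⇔ (M ⊨ᵃ w , emb (inst σ χ))
  ⊨ᵃ-inst σ v v⇔σ (pvar i) = v⇔σ i
  ⊨ᵃ-inst σ v v⇔σ (pneg χ) = ¬-cong-⇔ (⊨ᵃ-inst σ v v⇔σ χ) ⇔-∘ T-not (peval v χ)
  ⊨ᵃ-inst σ v v⇔σ (pand χ θ) = (⊨ᵃ-inst σ v v⇔σ χ ×-⇔ ⊨ᵃ-inst σ v v⇔σ θ) ⇔-∘ T-∧

  truth-value : Set → Bool
  truth-value A = ⌊ em {A} ⌋

  T-truth-value : ∀ A → T (truth-value A) ⇔ A
  T-truth-value A = mk⇔ toWitness fromWitness

  -- LT needs no modality hypothesis: truth is bisimulation invariant, so it holds for every ψ.
  ⊨ᵃ-sound : ∀ {φ} → ⊢ φ → ∀ M w → M ⊨ᵃ w , emb φ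
  ⊨ᵃ-sound (taut σ χ χ-taut) M w =
    to (⊨ᵃ-inst σ v (λ i → T-truth-value _) χ) (from T-≡ (χ-taut v))
    where
      v : ℕ → Bool
      v i = truth-value (M ⊨ᵃ w , emb (σ i))
  ⊨ᵃ-sound (K a φ ψ) M w = ⊃-intro λ □φ⊃ψ → ⊃-intro λ □φ v rv → ⊃-elim (□φ⊃ψ v rv) (□φ v rv)
  ⊨ᵃ-sound (MP ⊢φ⇒ψ ⊢φ) M w = ⊃-elim (⊨ᵃ-sound ⊢φ⇒ψ M w) (⊨ᵃ-sound ⊢φ M w)
  ⊨ᵃ-sound (Nec a ⊢φ) M w v _ = ⊨ᵃ-sound ⊢φ M v
  ⊨ᵃ-sound (LT φ ψ _) M w = ⇔⇒⊃⊂ (⊨ᵃ-[test] (emb φ) (emb ψ))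
  ⊨ᵃ-sound (LU α β φ) M w = ⇔⇒⊃⊂ (⊨ᵃ-[∪] (τ α) (τ β) (emb φ))
  ⊨ᵃ-sound (LS α β φ) M w = ⇔⇒⊃⊂ (⊨ᵃ-[⨾] (τ α) (τ β) (emb φ))
  ⊨ᵃ-sound (LP B _ α β q) M w = ⇔⇒⊃⊂ (⊨ᵃ-[learn]-atom B (unionPAM (τ α) (τ β)) q)
  ⊨ᵃ-sound (LN B _ α β φ) M w = ⇔⇒⊃⊂ (⊨ᵃ-[learn]-¬ B (unionPAM (τ α) (τ β)) (emb φ))
  ⊨ᵃ-sound (LC B _ α β φ ψ) M w =
    ⇔⇒⊃⊂ (⊨ᵃ-[learn]-∧ B (unionPAM (τ α) (τ β)) (emb φ) (emb ψ))
  ⊨ᵃ-sound (LK1 B _ α β a φ eq) M w =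
    ⇔⇒⊃⊂ (⊨ᵃ-[learn]-□-learner B (unionPAM (τ α) (τ β)) (emb φ) eq)
  ⊨ᵃ-sound (LK2 B _ α β a φ eq) M w =
    ⇔⇒⊃⊂ (⊨ᵃ-[learn]-□-other B (unionPAM (τ α) (τ β)) (emb φ) eq)
  ⊨ᵃ-sound (NecL α ⊢φ) = ⊨ᵃ-nec (τ α) (⊨ᵃ-sound ⊢φ)

  sound : ∀ {φ} → ⊢ φ → ∀ M w → M ⊨ w , φ
  sound {φ} ⊢φ M w = from (⊨⇔⊨ᵃ-emb φ) (⊨ᵃ-sound ⊢φ M w)

proposition5p2 :
    ExcludedMiddle 0ℓ →
    (k : ℕ) (Atom : Set) (p₀ : Atom) →
    Σ (Atom → ℕ) (λ f → Injective _≡_ _≡_ f) →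
    let open Logic (suc k) Atom p₀ in
    (φ : Form) → ⊢ φ → (M : Model) (w : S M) → M ⊨ w , φ
proposition5p2 em k Atom p₀ _ φ = Soundness.sound em (suc k) Atom p₀
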